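{- For every integer $k \ge 2$ and every $n$ such that there exists a hamiltonian $k$-regular graph of order $n$, we have $h_{2n-1}(2,k)=h_{2n}(2,k)=1$.
   Context: A graph is $(k,\ell)$-regular if all of its vertices have degree $k$ or $\ell$ and there is at least one vertex of degree $k$ and at least one vertex of degree $\ell$ (if $k=\ell$ this just means $k$-regular). $h_n(k,\ell)$ denotes the minimum number of hamiltonian cycles of any hamiltonian $(k,\ell)$-regular graph of order $n$ (with $h_n(k,\ell) := \infty$ if no such graph exists). -}

module Defs where

open import Data.Nat using (ℕ; zero; suc; _+_; _*_; _≤_)
open import Data.Nat.DivMod using (_%_; m%n<n)
open import Data.Bool using (Bool; true; false)
open import Data.Fin using (Fin; toℕ; fromℕ<)
open import Data.Fin.Subset using (∣_∣)
open import Data.Vec using (tabulate)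
open import Data.Product using (Σ; ∃; _×_; _,_)
open import Data.Sum using (_⊎_)
open import Function using (Injective)
open import Function.Bundles using (_⇔_)
open import Relation.Binary.PropositionalEquality using (_≡_)

record Graph (n : ℕ) : Set where
  field
    adj    : Fin n → Fin n → Bool
    sym    : ∀ x y → adj x y ≡ adj y x
    irrefl : ∀ x → adj x x ≡ false
open Graph public

degree : ∀ {n} → Graph n → Fin n → ℕ
degree G v = ∣ tabulate (adj G v) ∣

IsRegular₂ : ∀ {n} → ℕ → ℕ → Graph n → Set
IsRegular₂ k ℓ G =
  (∀ v → degree G v ≡ k ⊎ degree G v ≡ ℓ)
  × (∃ λ v → degree G v ≡ k) × (∃ λ v → degree G v ≡ ℓ)

next : ∀ {n} → Fin n → Fin n
next {suc m} i = fromℕ< (m%n<n (suc (toℕ i)) (suc m))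

EdgeSet : ℕ → Set
EdgeSet n = Fin n → Fin n → Bool

_≗E_ : ∀ {n} → EdgeSet n → EdgeSet n → Set
H ≗E H' = ∀ x y → H x y ≡ H' x y

-- H is (the edge set of) a hamiltonian cycle of G: n ≥ 3 and there is a
-- cyclic ordering f of all vertices (a bijection Fin n → Fin n) such that
-- H consists exactly of the edges {f i, f (i+1 mod n)}, all of which are edges of G.
IsHamCycle : ∀ {n} → Graph n → EdgeSet n → Set
IsHamCycle {n} G H =
  3 ≤ n × Σ (Fin n → Fin n) λ f → Injective _≡_ _≡_ f ×
    (∀ x y → (H x y ≡ true) ⇔
       (∃ λ i → (x ≡ f i × y ≡ f (next i)) ⊎ (y ≡ f i × x ≡ f (next i))))
    × (∀ i → adj G (f i) (f (next i)) ≡ true)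

Hamiltonian : ∀ {n} → Graph n → Set
Hamiltonian G = ∃ λ H → IsHamCycle G H

NumHamCycles : ∀ {n} → Graph n → ℕ → Set
NumHamCycles {n} G m =
  Σ (Fin m → EdgeSet n) λ cs →
    (∀ i → IsHamCycle G (cs i))
    × (∀ i j → cs i ≗E cs j → i ≡ j)
    × (∀ H → IsHamCycle G H → ∃ λ i → H ≗E cs i)

-- h_n(k,ℓ) = m  (m a natural number): m is the minimum number of hamiltonian
-- cycles over all hamiltonian (k,ℓ)-regular graphs of order n (and it is attained).
hEq : ℕ → ℕ → ℕ → ℕ → Set
hEq n k ℓ m =
  (Σ (Graph n) λ G → IsRegular₂ k ℓ G × Hamiltonian G × NumHamCycles G m)
  × (∀ (G : Graph n) → IsRegular₂ k ℓ G → Hamiltonian G →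
       ∀ m' → NumHamCycles G m' → m ≤ m')

-- Relabel a hamiltonian k-regular graph G of order n so that its hamiltonian cycle is
-- 0, 1, …, n − 1, and call the remaining edges of G chords.  On N = 2n or N = 2n − 1
-- vertices take the cycle 0, 1, …, N − 1 and join 2i to 2j whenever ij is a chord of G.
-- Odd vertices then have degree 2 and even vertices degree 2 + (k − 2) = k.  A hamiltonian
-- cycle uses both edges at a vertex of degree 2, hence both cycle edges at every even vertex
-- whose cycle neighbours are odd.  That leaves only the edge {N − 1, 0} undetermined, and a
-- vertex of a hamiltonian cycle has two cycle edges, so it is forced too: the N-cycle is the
-- only hamiltonian cycle.
module Submission where

open import Defs renaming (sym to adj-sym; irrefl to adj-irrefl)

open import Data.Bool using (Bool; true; false; _∧_; _∨_; not; if_then_else_)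
open import Data.Bool.Properties as Bool using (⇔→≡; ¬-not; ∨-comm; ∨-identityʳ; ∧-zeroʳ; not-injective)
open import Data.Empty using (⊥-elim)
open import Data.Fin using (Fin; zero; suc; toℕ; fromℕ; fromℕ<; punchOut)
open import Data.Fin.Properties
  using ( _≟_; nonZeroIndex; toℕ-injective; toℕ-fromℕ; toℕ-fromℕ<; toℕ≤pred[n]; any?
        ; punchOut-injective; injective⇒≤)
open import Data.Fin.Permutation using (permutation)
open import Data.Fin.Subset using (∣_∣)
open import Data.Nat using (ℕ; zero; suc; >-nonZero⁻¹; _+_; _*_; _∸_; _%_; _≤_; z≤n; s≤s)
open import Data.Nat.DivMod using (m<n⇒m%n≡m; n%n≡0)
open import Data.Nat.Properties
  using ( +-0-commutativeMonoid; +-comm; *-suc; suc-injective; 1+n≢n; <⇒≢; m<n⇒m<1+n; n<1+n; n≤1+n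
        ; ≤∧≢⇒<; <-irrefl; ≤-trans)
open import Algebra.Properties.CommutativeMonoid.Sum +-0-commutativeMonoid
  using (sum; sum-cong-≗; sum-permute; ∑-distrib-+; sum-replicate-zero)
open import Data.Product using (Σ; ∃; ∃₂; _×_; _,_; proj₁; proj₂)
open import Data.Sum using (_⊎_; inj₁; inj₂; reduce)
open import Data.Vec using (tabulate)
open import Function using (Injective; _∘_; id)
open import Function.Bundles using (_⇔_; mk⇔; Equivalence)
open import Relation.Nullary using (yes; no; does)
open import Relation.Nullary.Decidable using (dec-true; dec-false; does-⇔)
open import Relation.Binary.PropositionalEquality

indicator : Bool → ℕ
indicator b = if b then 1 else 0

count : ∀ {n} → (Fin n → Bool) → ℕ
count p = sum (indicator ∘ p)

degree≡count : ∀ {n} (G : Graph n) v → degree G v ≡ count (adj G v)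
degree≡count G v = size-tabulate (adj G v)
  where
  size-tabulate : ∀ {n} (p : Fin n → Bool) → ∣ tabulate p ∣ ≡ count p
  size-tabulate {zero} p = refl
  size-tabulate {suc n} p with p zero
  ... | true = cong suc (size-tabulate (p ∘ suc))
  ... | false = size-tabulate (p ∘ suc)

count-cong : ∀ {n} {p q : Fin n → Bool} → (∀ x → p x ≡ q x) → count p ≡ count q
count-cong p≗q = sum-cong-≗ (cong indicator ∘ p≗q)

count-false : ∀ {n} → count {n} (λ _ → false) ≡ 0
count-false {n} = sum-replicate-zero n

count-∨-disjoint : ∀ {n} (p q : Fin n → Bool) → (∀ x → p x ≡ true → q x ≡ false) →
  count (λ x → p x ∨ q x) ≡ count p + count q
count-∨-disjoint p q disjoint =
  trans (sum-cong-≗ pointwise) (∑-distrib-+ (indicator ∘ p) (indicator ∘ q))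
  where
  pointwise : ∀ x → indicator (p x ∨ q x) ≡ indicator (p x) + indicator (q x)
  pointwise x with p x in px | q x in qx
  ... | true  | true  with () ← trans (sym qx) (disjoint x px)
  ... | true  | false = refl
  ... | false | _     = refl

count-∧-not : ∀ {n} (p q : Fin n → Bool) → (∀ x → q x ≡ true → p x ≡ true) →
  count (λ x → p x ∧ not (q x)) + count q ≡ count p
count-∧-not p q q⊆p =
  trans (sym (∑-distrib-+ (λ x → indicator (p x ∧ not (q x))) (indicator ∘ q))) (sum-cong-≗ pointwise)
  where
  pointwise : ∀ x → indicator (p x ∧ not (q x)) + indicator (q x) ≡ indicator (p x)
  pointwise x with p x in px | q x in qx
  ... | true  | true  = refl
  ... | true  | false = refl
  ... | false | true  with () ← trans (sym px) (q⊆p x qx)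
  ... | false | false = refl

count-≟ : ∀ {n} (a : Fin n) → count (λ x → does (x ≟ a)) ≡ 1
count-≟ {suc n} zero = cong suc (count-false {n})
count-≟ (suc a) = count-≟ a

injective⇒surjective : ∀ {n} {f : Fin n → Fin n} → Injective _≡_ _≡_ f → ∀ y → ∃ λ x → f x ≡ y
injective⇒surjective {zero} f-inj ()
injective⇒surjective {suc m} {f} f-inj y with any? (λ x → f x ≟ y)
... | yes hit = hit
... | no miss = ⊥-elim (<-irrefl refl (injective⇒≤ g-injective))
  where
  g : Fin (suc m) → Fin m
  g x = punchOut {i = y} {j = f x} (λ e → miss (x , sym e))
  g-injective : Injective _≡_ _≡_ g
  g-injective {a} {b} e = f-inj (punchOut-injective (λ e → miss (a , sym e)) (λ e → miss (b , sym e)) e)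

count-∘-injective : ∀ {n} {f : Fin n → Fin n} → Injective _≡_ _≡_ f → (p : Fin n → Bool) →
  count (p ∘ f) ≡ count p
count-∘-injective {f = f} f-inj p = sym (sum-permute (indicator ∘ p) π)
  where
  f⁻¹ : _ → _
  f⁻¹ y = proj₁ (injective⇒surjective f-inj y)
  π = permutation f f⁻¹ (λ y → proj₂ (injective⇒surjective f-inj y))
                        (λ x → f-inj (proj₂ (injective⇒surjective f-inj (f x))))

data NextView {M} (u : Fin (suc M)) : Set where
  wraps : u ≡ fromℕ M → next u ≡ zero → NextView u
  steps : u ≢ fromℕ M → toℕ (next u) ≡ suc (toℕ u) → NextView u

toℕ-next : ∀ {M} (u : Fin (suc M)) → toℕ (next u) ≡ suc (toℕ u) % suc M
toℕ-next u = toℕ-fromℕ< _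

nextView : ∀ {M} (u : Fin (suc M)) → NextView u
nextView {M} u with u ≟ fromℕ M
... | yes refl = wraps refl (toℕ-injective (begin
  toℕ (next (fromℕ M))        ≡⟨ toℕ-next (fromℕ M) ⟩
  suc (toℕ (fromℕ M)) % suc M ≡⟨ cong (λ m → suc m % suc M) (toℕ-fromℕ M) ⟩
  suc M % suc M               ≡⟨ n%n≡0 (suc M) ⟩
  0                           ∎))
  where open ≡-Reasoning
... | no u≢last = steps u≢last (trans (toℕ-next u) (m<n⇒m%n≡m (s≤s (≤∧≢⇒< (toℕ≤pred[n] u) toℕu≢M))))
  where
  toℕu≢M : toℕ u ≢ M
  toℕu≢M e = u≢last (toℕ-injective (trans e (sym (toℕ-fromℕ M))))

next-injective : ∀ {N} → Injective _≡_ _≡_ (next {N})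
next-injective {suc M} {a} {b} e with nextView a | nextView b
... | wraps refl _  | wraps refl _  = refl
... | wraps _ wa    | steps _ sb    with () ← trans (sym sb) (cong toℕ (trans (sym e) wa))
... | steps _ sa    | wraps _ wb    with () ← trans (sym sa) (cong toℕ (trans e wb))
... | steps _ sa    | steps _ sb    = toℕ-injective (suc-injective (trans (sym sa) (trans (cong toℕ e) sb)))

next-surjective : ∀ {N} (v : Fin N) → ∃ λ u → next u ≡ v
next-surjective = injective⇒surjective next-injective

next≢id : ∀ {N} → 2 ≤ N → (u : Fin N) → next u ≢ u
next≢id {suc M} (s≤s 1≤M) u e with nextView u
... | steps _ su = 1+n≢n (trans (sym su) (cong toℕ e))
... | wraps refl wu with trans (sym (toℕ-fromℕ M)) (cong toℕ (trans (sym e) wu)) | 1≤M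
...   | refl | ()

next²≢id : ∀ {N} → 3 ≤ N → (u : Fin N) → next (next u) ≢ u
next²≢id {suc M} (s≤s 2≤M) u e with nextView u | nextView (next u)
... | steps _ su | steps _ ssu =
  <⇒≢ (m<n⇒m<1+n (n<1+n (toℕ u))) (sym (trans (sym (trans ssu (cong suc su))) (cong toℕ e)))
... | wraps refl wu | wraps w′ _ with trans (sym (toℕ-fromℕ M)) (cong toℕ (trans (sym w′) wu)) | 2≤M
...   | refl | ()
next²≢id {suc M} (s≤s 2≤M) u e | wraps refl wu | steps _ s′
  with trans (sym (toℕ-fromℕ M)) (trans (cong toℕ (sym e)) (trans s′ (cong (suc ∘ toℕ) wu))) | 2≤M
...   | refl | s≤s ()
next²≢id {suc M} (s≤s 2≤M) u e | steps _ su | wraps w′ ww′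
  with trans (sym (toℕ-fromℕ M)) (trans (cong toℕ (sym w′)) (trans su (cong (suc ∘ toℕ) (trans (sym e) ww′)))) | 2≤M
...   | refl | s≤s ()

toℕ-next-last : ∀ {N} (u : Fin N) → suc (toℕ u) ≡ N → toℕ (next u) ≡ 0
toℕ-next-last {suc M} u last with nextView u
... | wraps _ next≡0 = cong toℕ next≡0
... | steps u≢last _ = ⊥-elim (u≢last (toℕ-injective (trans (suc-injective last) (sym (toℕ-fromℕ M)))))

cycleAdj : ∀ {N} → Fin N → Fin N → Bool
cycleAdj u v = does (v ≟ next u) ∨ does (u ≟ next v)

cycleAdj-sym : ∀ {N} (u v : Fin N) → cycleAdj u v ≡ cycleAdj v u
cycleAdj-sym u v = ∨-comm (does (v ≟ next u)) (does (u ≟ next v))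

cycleAdj-irrefl : ∀ {N} → 2 ≤ N → (u : Fin N) → cycleAdj u u ≡ false
cycleAdj-irrefl 2≤N u = cong₂ _∨_ u≢next u≢next
  where u≢next = dec-false (u ≟ next u) (λ e → next≢id 2≤N u (sym e))

cycleAdj-next : ∀ {N} (u : Fin N) → cycleAdj u (next u) ≡ true
cycleAdj-next u = cong (_∨ does (u ≟ next (next u))) (dec-true (next u ≟ next u) refl)

cycleAdj-prev : ∀ {N} (u : Fin N) → cycleAdj (next u) u ≡ true
cycleAdj-prev u = trans (cycleAdj-sym (next u) u) (cycleAdj-next u)

cycleAdj-cases : ∀ {N} {u v : Fin N} → cycleAdj u v ≡ true → v ≡ next u ⊎ u ≡ next v
cycleAdj-cases {u = u} {v} c with v ≟ next u | u ≟ next v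
... | yes v≡next | _         = inj₁ v≡next
... | no _       | yes u≡next = inj₂ u≡next

cycleAdj-neighbours : ∀ {N} {v a b c : Fin N} → cycleAdj v a ≡ true → cycleAdj v b ≡ true → a ≢ b →
  cycleAdj v c ≡ true → c ≡ a ⊎ c ≡ b
cycleAdj-neighbours {v = v} {a} {b} {c} va vb a≢b vc
  with cycleAdj-cases {u = v} {a} va | cycleAdj-cases {u = v} {b} vb | cycleAdj-cases {u = v} {c} vc
... | inj₁ refl | inj₁ refl | _         = ⊥-elim (a≢b refl)
... | inj₂ p    | inj₂ q    | _         = ⊥-elim (a≢b (next-injective (trans (sym p) q)))
... | inj₁ refl | inj₂ _    | inj₁ refl = inj₁ refl
... | inj₁ _    | inj₂ q    | inj₂ r    = inj₂ (next-injective (trans (sym r) q))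
... | inj₂ _    | inj₁ refl | inj₁ refl = inj₂ refl
... | inj₂ p    | inj₁ _    | inj₂ r    = inj₁ (next-injective (trans (sym r) p))

count-cycleAdj : ∀ {N} → 3 ≤ N → (u : Fin N) → count (cycleAdj u) ≡ 2
count-cycleAdj 3≤N u with next-surjective u
... | p , next-p≡u = begin
  count (cycleAdj u)                                                ≡⟨ count-∨-disjoint _ _ disjoint ⟩
  count (λ v → does (v ≟ next u)) + count (λ v → does (u ≟ next v)) ≡⟨ cong (_ +_) (count-cong predecessor) ⟩
  count (λ v → does (v ≟ next u)) + count (λ v → does (v ≟ p))      ≡⟨ cong₂ _+_ (count-≟ (next u)) (count-≟ p) ⟩
  2                                                                 ∎
  where
  open ≡-Reasoning
  disjoint : ∀ v → does (v ≟ next u) ≡ true → does (u ≟ next v) ≡ false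
  disjoint v _ with v ≟ next u
  ... | yes refl = dec-false (u ≟ next (next u)) (λ e → next²≢id 3≤N u (sym e))
  predecessor : ∀ v → does (u ≟ next v) ≡ does (v ≟ p)
  predecessor v = does-⇔ (mk⇔ (λ e → next-injective (trans (sym e) (sym next-p≡u)))
                             (λ { refl → sym next-p≡u })) (u ≟ next v) (v ≟ p)

cycleAdj-isHamCycle : ∀ {N} (G : Graph N) → 3 ≤ N → (∀ u → adj G u (next u) ≡ true) → IsHamCycle G cycleAdj
cycleAdj-isHamCycle G 3≤N cycle⊆G = 3≤N , id , id , (λ x y → mk⇔ consecutive adjacent) , cycle⊆G
  where
  consecutive : ∀ {x y} → cycleAdj x y ≡ true → ∃ λ i → (x ≡ i × y ≡ next i) ⊎ (y ≡ i × x ≡ next i)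
  consecutive {x} {y} c with cycleAdj-cases {u = x} {y} c
  ... | inj₁ y≡next = x , inj₁ (refl , y≡next)
  ... | inj₂ x≡next = y , inj₂ (refl , x≡next)
  adjacent : ∀ {x y} → (∃ λ i → (x ≡ i × y ≡ next i) ⊎ (y ≡ i × x ≡ next i)) → cycleAdj x y ≡ true
  adjacent (i , inj₁ (refl , refl)) = cycleAdj-next i
  adjacent (i , inj₂ (refl , refl)) = cycleAdj-prev i

pair-⊆-pair : ∀ {A : Set} {a b a′ b′ c : A} → a ≢ b → (a ≡ a′ ⊎ a ≡ b′) → (b ≡ a′ ⊎ b ≡ b′) →
  (c ≡ a′ ⊎ c ≡ b′) → c ≡ a ⊎ c ≡ b
pair-⊆-pair a≢b (inj₁ refl) (inj₁ refl) _          = ⊥-elim (a≢b refl)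
pair-⊆-pair a≢b (inj₂ refl) (inj₂ refl) _          = ⊥-elim (a≢b refl)
pair-⊆-pair _   (inj₁ refl) (inj₂ refl) c∈         = c∈
pair-⊆-pair _   (inj₂ refl) (inj₁ refl) (inj₁ c≡a′) = inj₂ c≡a′
pair-⊆-pair _   (inj₂ refl) (inj₁ refl) (inj₂ c≡b′) = inj₁ c≡b′

module HamCycle {N} (G : Graph N) {H : EdgeSet N} (hc : IsHamCycle G H) where

  3≤N : 3 ≤ N
  3≤N = proj₁ hc

  f : Fin N → Fin N
  f = proj₁ (proj₂ hc)

  f-injective : Injective _≡_ _≡_ f
  f-injective = proj₁ (proj₂ (proj₂ hc))

  Consecutive : Fin N → Fin N → Set
  Consecutive x y = ∃ λ i → (x ≡ f i × y ≡ f (next i)) ⊎ (y ≡ f i × x ≡ f (next i))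

  private
    consecutive : ∀ {x y} → H x y ≡ true → Consecutive x y
    consecutive = Equivalence.to (proj₁ (proj₂ (proj₂ (proj₂ hc))) _ _)

    H-intro : ∀ {x y} → Consecutive x y → H x y ≡ true
    H-intro = Equivalence.from (proj₁ (proj₂ (proj₂ (proj₂ hc))) _ _)

  f-adj : ∀ i → adj G (f i) (f (next i)) ≡ true
  f-adj = proj₂ (proj₂ (proj₂ (proj₂ hc)))

  cycleAdj⇒adj : ∀ {i j} → cycleAdj i j ≡ true → adj G (f i) (f j) ≡ true
  cycleAdj⇒adj {i} {j} c with cycleAdj-cases {u = i} {j} c
  ... | inj₁ refl = f-adj i
  ... | inj₂ refl = trans (adj-sym G _ _) (f-adj j)

  H-sym : ∀ {x y} → H x y ≡ true → H y x ≡ true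
  H-sym h with consecutive h
  ... | i , inj₁ xy = H-intro (i , inj₂ xy)
  ... | i , inj₂ yx = H-intro (i , inj₁ yx)

  H⇒adj : ∀ {x y} → H x y ≡ true → adj G x y ≡ true
  H⇒adj h with consecutive h
  ... | i , inj₁ (refl , refl) = f-adj i
  ... | i , inj₂ (refl , refl) = trans (adj-sym G _ _) (f-adj i)

  H-two-neighbours : ∀ v → ∃₂ λ a b → a ≢ b × H v a ≡ true × H v b ≡ true ×
    (∀ c → H v c ≡ true → c ≡ a ⊎ c ≡ b)
  H-two-neighbours v with injective⇒surjective f-injective v
  ... | j , refl with next-surjective j
  ...   | i , refl = f (next (next i)) , f i , (λ e → next²≢id 3≤N i (f-injective e)) ,
                     H-intro (next i , inj₁ (refl , refl)) , H-intro (i , inj₂ (refl , refl)) , only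
    where
    only : ∀ c → H (f (next i)) c ≡ true → c ≡ f (next (next i)) ⊎ c ≡ f i
    only c h with consecutive h
    ... | i′ , inj₁ (p , q) with f-injective p
    ...   | refl = inj₁ q
    only c h | i′ , inj₂ (p , q) with next-injective (f-injective q)
    ...   | refl = inj₂ p

  H-neighbours : ∀ {v a b c} → H v a ≡ true → H v b ≡ true → a ≢ b → H v c ≡ true → c ≡ a ⊎ c ≡ b
  H-neighbours {v} {a} {b} {c} va vb a≢b vc with H-two-neighbours v
  ... | _ , _ , _ , _ , _ , only = pair-⊆-pair a≢b (only a va) (only b vb) (only c vc)

  AgreesAt : Fin N → Set
  AgreesAt v = ∀ c → H v c ≡ cycleAdj v c

  agreesAt-of-shared-neighbours : ∀ {v a b} → H v a ≡ true → H v b ≡ true →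
    cycleAdj v a ≡ true → cycleAdj v b ≡ true → a ≢ b → AgreesAt v
  agreesAt-of-shared-neighbours {v} {a} {b} Hva Hvb Cva Cvb a≢b c = ⇔→≡ (mk⇔ H⇒C C⇒H)
    where
    H⇒C : H v c ≡ true → cycleAdj v c ≡ true
    H⇒C h with H-neighbours Hva Hvb a≢b h
    ... | inj₁ refl = Cva
    ... | inj₂ refl = Cvb
    C⇒H : cycleAdj v c ≡ true → H v c ≡ true
    C⇒H h with cycleAdj-neighbours Cva Cvb a≢b h
    ... | inj₁ refl = Hva
    ... | inj₂ refl = Hvb

  agreesAt-of-adj⊆cycleAdj : ∀ {v} → (∀ c → adj G v c ≡ true → cycleAdj v c ≡ true) → AgreesAt v
  agreesAt-of-adj⊆cycleAdj {v} thin with H-two-neighbours v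
  ... | a , b , a≢b , Hva , Hvb , _ =
    agreesAt-of-shared-neighbours Hva Hvb (thin a (H⇒adj Hva)) (thin b (H⇒adj Hvb)) a≢b

  agreesAt-between : ∀ {p} → AgreesAt p → AgreesAt (next (next p)) → AgreesAt (next p)
  agreesAt-between {p} agree-p agree-nnp =
    agreesAt-of-shared-neighbours (H-sym (trans (agree-nnp (next p)) (cycleAdj-prev (next p))))
                 (H-sym (trans (agree-p (next p)) (cycleAdj-next p)))
                 (cycleAdj-next (next p)) (cycleAdj-prev p) (next²≢id 3≤N p)

  agreesAt-everywhere : ∀ ℓ → (∀ u → u ≢ next ℓ → u ≢ ℓ → AgreesAt u) → H ≗E cycleAdj
  agreesAt-everywhere ℓ agree x = agreesAt-all x
    where
    z = next ℓ
    2≤N = ≤-trans (s≤s (s≤s z≤n)) 3≤N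

    agree-next-z : AgreesAt (next z)
    agree-next-z = agree (next z) (next≢id 2≤N z) (next²≢id 3≤N ℓ)

    neighbour-of-z : ∀ c → H z c ≡ true → c ≢ next z → c ≡ ℓ
    neighbour-of-z c Hzc c≢next-z with c ≟ ℓ
    ... | yes c≡ℓ = c≡ℓ
    ... | no c≢ℓ with c ≟ z
    ...   | yes refl with () ← trans (sym (H⇒adj Hzc)) (adj-irrefl G c)
    ...   | no c≢z with cycleAdj-cases {u = c} {z} (trans (sym (agree c c≢z c≢ℓ z)) (H-sym Hzc))
    ...     | inj₁ z≡next-c = next-injective (sym z≡next-c)
    ...     | inj₂ c≡next-z = ⊥-elim (c≢next-z c≡next-z)

    Hzℓ : H z ℓ ≡ true
    Hzℓ with H-two-neighbours z
    ... | a , b , a≢b , Hza , Hzb , _ with a ≟ next z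
    ...   | yes refl = subst (λ c → H z c ≡ true) (neighbour-of-z b Hzb (λ e → a≢b (sym e))) Hzb
    ...   | no a≢next-z = subst (λ c → H z c ≡ true) (neighbour-of-z a Hza a≢next-z) Hza

    agree-z : AgreesAt z
    agree-z = agreesAt-of-shared-neighbours (H-sym (trans (agree-next-z z) (cycleAdj-prev z))) Hzℓ
                           (cycleAdj-next z) (cycleAdj-prev ℓ) (next²≢id 3≤N ℓ)

    agree-ℓ : AgreesAt ℓ
    agree-ℓ with next-surjective ℓ
    ... | q , refl = agreesAt-between (agree q (next²≢id 3≤N q ∘ sym) (next≢id 2≤N q ∘ sym)) agree-z

    agreesAt-all : ∀ u → AgreesAt u
    agreesAt-all u with u ≟ z | u ≟ ℓ
    ... | yes refl | _        = agree-z
    ... | no _     | yes refl = agree-ℓ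
    ... | no u≢z   | no u≢ℓ   = agree u u≢z u≢ℓ

even : ℕ → Bool
even zero          = true
even (suc zero)    = false
even (suc (suc n)) = even n

even-suc : ∀ n → even (suc n) ≡ not (even n)
even-suc zero          = refl
even-suc (suc zero)    = refl
even-suc (suc (suc n)) = even-suc n

even-next : ∀ {M} (u : Fin (suc M)) → u ≢ fromℕ M → even (toℕ (next u)) ≡ not (even (toℕ u))
even-next u u≢last with nextView u
... | wraps u≡last _  = ⊥-elim (u≢last u≡last)
... | steps _ next≡suc = trans (cong even next≡suc) (even-suc (toℕ u))

-- Halving N n holds exactly when n = ⌈ N /2⌉, and half sends w to ⌊ w /2⌋.
data Halving : ℕ → ℕ → Set where
  halving-0  : Halving 0 0
  halving-1  : Halving 1 1
  halving-+2 : ∀ {N n} → Halving N n → Halving (2 + N) (suc n)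

half : ∀ {N n} → Halving N n → Fin N → Fin n
half halving-1      zero          = zero
half (halving-+2 h) zero          = zero
half (halving-+2 h) (suc zero)    = zero
half (halving-+2 h) (suc (suc w)) = suc (half h w)

halving-≤ : ∀ {N n} → Halving N n → n ≤ N
halving-≤ halving-0      = z≤n
halving-≤ halving-1      = s≤s z≤n
halving-≤ (halving-+2 h) = s≤s (≤-trans (halving-≤ h) (n≤1+n _))

halving-double : ∀ n → Halving (2 * n) n
halving-double zero    = halving-0
halving-double (suc n) = subst (λ N → Halving N (suc n)) (sym (*-suc 2 n)) (halving-+2 (halving-double n))

halving-double-pred : ∀ n → Halving (suc (2 * n)) (suc n)
halving-double-pred zero    = halving-1
halving-double-pred (suc n) =
  subst (λ N → Halving (suc N) (suc (suc n))) (sym (*-suc 2 n)) (halving-+2 (halving-double-pred n))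

count-evens : ∀ {N n} (h : Halving N n) (q : Fin n → Bool) →
  count (λ w → even (toℕ w) ∧ q (half h w)) ≡ count q
count-evens halving-0      q = refl
count-evens halving-1      q = refl
count-evens (halving-+2 h) q = cong (indicator (q zero) +_) (count-evens h (q ∘ suc))

toℕ-half-zero : ∀ {N n} (h : Halving (suc N) n) → toℕ (half h zero) ≡ 0
toℕ-half-zero halving-1      = refl
toℕ-half-zero (halving-+2 h) = refl

half-last : ∀ {N n} (h : Halving N n) (w : Fin N) → suc (toℕ w) ≡ N → even (toℕ w) ≡ true →
  suc (toℕ (half h w)) ≡ n
half-last halving-1      zero          _    _    = refl
half-last (halving-+2 h) (suc (suc w)) last even =
  cong suc (half-last h w (suc-injective (suc-injective last)) even)

hEq-one : ∀ {N k ℓ} (Γ : Graph N) → IsRegular₂ k ℓ Γ → ∀ {C} → IsHamCycle Γ C →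
  (∀ {H} → IsHamCycle Γ H → H ≗E C) → hEq N k ℓ 1
hEq-one Γ regular {C} hc unique =
  (Γ , regular , (C , hc) , (λ _ → C) , (λ _ → hc) , (λ { zero zero _ → refl }) , (λ _ hH → zero , unique hH)) ,
  at-least-one
  where
  at-least-one : ∀ G → _ → Hamiltonian G → ∀ m → NumHamCycles G m → 1 ≤ m
  at-least-one G _ (H , hH) m (_ , _ , _ , complete) = >-nonZero⁻¹ m {{nonZeroIndex (proj₁ (complete H hH))}}

module Doubling {n k} (G : Graph n) (G-regular : ∀ v → degree G v ≡ k)
                {H} (hc : IsHamCycle G H) {M} (h : Halving (suc M) n) where
  open HamCycle G hc using (f; f-injective; cycleAdj⇒adj) renaming (3≤N to 3≤n)

  3≤N : 3 ≤ suc M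
  3≤N = ≤-trans 3≤n (halving-≤ h)

  2≤N : 2 ≤ suc M
  2≤N = ≤-trans (s≤s (s≤s z≤n)) 3≤N

  chords : Fin n → Fin n → Bool
  chords i j = adj G (f i) (f j) ∧ not (cycleAdj i j)

  count-chords : ∀ i → count (chords i) + 2 ≡ k
  count-chords i = begin
    count (chords i) + 2                  ≡⟨ cong (count (chords i) +_) (sym (count-cycleAdj 3≤n i)) ⟩
    count (chords i) + count (cycleAdj i) ≡⟨ count-∧-not (adj G (f i) ∘ f) (cycleAdj i) (λ _ → cycleAdj⇒adj) ⟩
    count (adj G (f i) ∘ f)               ≡⟨ count-∘-injective f-injective (adj G (f i)) ⟩
    count (adj G (f i))                   ≡⟨ sym (degree≡count G (f i)) ⟩
    degree G (f i)                        ≡⟨ G-regular (f i) ⟩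
    k                                     ∎
    where open ≡-Reasoning

  chords-sym : ∀ i j → chords i j ≡ chords j i
  chords-sym i j = cong₂ (λ a b → a ∧ not b) (adj-sym G (f i) (f j)) (cycleAdj-sym i j)

  chords-next : ∀ i → chords i (next i) ≡ false
  chords-next i = trans (cong (λ b → adj G (f i) (f (next i)) ∧ not b) (cycleAdj-next i)) (∧-zeroʳ _)

  chord : Fin (suc M) → Fin (suc M) → Bool
  chord u w = even (toℕ u) ∧ (even (toℕ w) ∧ chords (half h u) (half h w))

  chord-odd : ∀ u w → even (toℕ u) ≡ false → chord u w ≡ false
  chord-odd u w odd rewrite odd = refl

  chord-sym : ∀ u w → chord u w ≡ chord w u
  chord-sym u w with even (toℕ u) | even (toℕ w)
  ... | true  | true  = chords-sym (half h u) (half h w)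
  ... | true  | false = refl
  ... | false | true  = refl
  ... | false | false = refl

  chord-irrefl : ∀ u → chord u u ≡ false
  chord-irrefl u with even (toℕ u)
  ... | true  rewrite adj-irrefl G (f (half h u)) = refl
  ... | false = refl

  chord-next : ∀ u → chord u (next u) ≡ false
  chord-next u with nextView u
  ... | steps u≢last _ with even (toℕ u) in parity | even-next u u≢last
  ...   | true  | next-odd rewrite next-odd = refl
  ...   | false | _ = refl
  chord-next u | wraps refl next≡0 with even (toℕ u) in parity
  ...   | false = refl
  -- When N is odd both ends of the wrap-around edge are even, but their halves are
  -- consecutive on the cycle of G, so they span no chord.
  ...   | true rewrite next≡0 = trans (cong (chords (half h u)) half-0≡next) (chords-next (half h u))
    where
    half-0≡next : half h zero ≡ next (half h u)
    half-0≡next = toℕ-injective (trans (toℕ-half-zero h)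
                    (sym (toℕ-next-last (half h u) (half-last h u (cong suc (toℕ-fromℕ M)) parity))))

  chord-cycleAdj-disjoint : ∀ u w → cycleAdj u w ≡ true → chord u w ≡ false
  chord-cycleAdj-disjoint u w c with cycleAdj-cases {u = u} {w} c
  ... | inj₁ refl = chord-next u
  ... | inj₂ refl = trans (chord-sym (next w) w) (chord-next w)

  Γ : Graph (suc M)
  Γ = record
    { adj    = λ u w → cycleAdj u w ∨ chord u w
    ; sym    = λ u w → cong₂ _∨_ (cycleAdj-sym u w) (chord-sym u w)
    ; irrefl = λ u → cong₂ _∨_ (cycleAdj-irrefl 2≤N u) (chord-irrefl u)
    }

  degree-Γ : ∀ u → degree Γ u ≡ 2 + count (chord u)
  degree-Γ u = begin
    degree Γ u                             ≡⟨ degree≡count Γ u ⟩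
    count (λ w → cycleAdj u w ∨ chord u w) ≡⟨ count-∨-disjoint (cycleAdj u) (chord u) (chord-cycleAdj-disjoint u) ⟩
    count (cycleAdj u) + count (chord u)   ≡⟨ cong (_+ count (chord u)) (count-cycleAdj 3≤N u) ⟩
    2 + count (chord u)                    ∎
    where open ≡-Reasoning

  degree-Γ-odd : ∀ u → even (toℕ u) ≡ false → degree Γ u ≡ 2
  degree-Γ-odd u odd = begin
    degree Γ u          ≡⟨ degree-Γ u ⟩
    2 + count (chord u) ≡⟨ cong (2 +_) (trans (count-cong (λ w → chord-odd u w odd)) (count-false {suc M})) ⟩
    2                   ∎
    where open ≡-Reasoning

  degree-Γ-even : ∀ u → even (toℕ u) ≡ true → degree Γ u ≡ k
  degree-Γ-even u even-u = begin
    degree Γ u                                                    ≡⟨ degree-Γ u ⟩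
    2 + count (chord u)                                           ≡⟨ cong (2 +_) (count-cong unfold-chord) ⟩
    2 + count (λ w → even (toℕ w) ∧ chords (half h u) (half h w)) ≡⟨ cong (2 +_) (count-evens h (chords (half h u))) ⟩
    2 + count (chords (half h u))                                 ≡⟨ +-comm 2 _ ⟩
    count (chords (half h u)) + 2                                 ≡⟨ count-chords (half h u) ⟩
    k                                                             ∎
    where
    open ≡-Reasoning
    unfold-chord : ∀ w → chord u w ≡ even (toℕ w) ∧ chords (half h u) (half h w)
    unfold-chord w = cong (_∧ (even (toℕ w) ∧ chords (half h u) (half h w))) even-u

  Γ-regular : IsRegular₂ 2 k Γ
  Γ-regular = degree-2-or-k , (one , degree-Γ-odd one (cong even (toℕ-fromℕ< 2≤N)))
                            , (zero , degree-Γ-even zero refl)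
    where
    one : Fin (suc M)
    one = fromℕ< 2≤N
    degree-2-or-k : ∀ u → degree Γ u ≡ 2 ⊎ degree Γ u ≡ k
    degree-2-or-k u with even (toℕ u) Bool.≟ true
    ... | yes even-u = inj₂ (degree-Γ-even u even-u)
    ... | no ¬even-u = inj₁ (degree-Γ-odd u (¬-not ¬even-u))

  Γ-hamCycle : IsHamCycle Γ cycleAdj
  Γ-hamCycle = cycleAdj-isHamCycle Γ 3≤N (λ u → cong (_∨ chord u (next u)) (cycleAdj-next u))

  Γ-unique : ∀ {H′} → IsHamCycle Γ H′ → H′ ≗E cycleAdj
  Γ-unique hc′ = agreesAt-everywhere (fromℕ M) agreesAt-off-wrap
    where
    open HamCycle Γ hc′ using (AgreesAt; agreesAt-of-adj⊆cycleAdj; agreesAt-between; agreesAt-everywhere)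

    agreesAt-odd : ∀ u → even (toℕ u) ≡ false → AgreesAt u
    agreesAt-odd u odd = agreesAt-of-adj⊆cycleAdj λ c Γuc →
      trans (sym (∨-identityʳ (cycleAdj u c))) (trans (cong (cycleAdj u c ∨_) (sym (chord-odd u c odd))) Γuc)

    agreesAt-off-wrap : ∀ u → u ≢ next (fromℕ M) → u ≢ fromℕ M → AgreesAt u
    agreesAt-off-wrap u u≢first u≢last with even (toℕ u) in parity
    ... | false = agreesAt-odd u parity
    ... | true with next-surjective u
    ...   | p , refl = agreesAt-between (agreesAt-odd p p-odd) (agreesAt-odd (next (next p)) next-odd)
      where
      p-odd : even (toℕ p) ≡ false
      p-odd = not-injective (trans (sym (even-next p (u≢first ∘ cong next))) parity)
      next-odd : even (toℕ (next (next p))) ≡ false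
      next-odd = trans (even-next (next p) u≢last) (cong not parity)

  doubling-hEq : hEq (suc M) 2 k 1
  doubling-hEq = hEq-one Γ Γ-regular Γ-hamCycle Γ-unique

mainTheorem8 : ∀ (k : ℕ) → 2 ≤ k → ∀ (n : ℕ) →
    Σ (Graph n) (λ G → IsRegular₂ k k G × Hamiltonian G) →
    hEq (2 * n ∸ 1) 2 k 1 × hEq (2 * n) 2 k 1
mainTheorem8 k _ zero (_ , _ , _ , () , _)
mainTheorem8 k _ (suc n) (G , regular , _ , hc) =
    subst (λ N → hEq N 2 k 1) odd-order (Doubling.doubling-hEq G G-regular hc (halving-double-pred n))
  , Doubling.doubling-hEq G G-regular hc (halving-double (suc n))
  where
  G-regular : ∀ v → degree G v ≡ k
  G-regular v = reduce (proj₁ regular v)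

  odd-order : suc (2 * n) ≡ 2 * suc n ∸ 1
  odd-order = cong (_∸ 1) (sym (*-suc 2 n))
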